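{- Let $T$ be a spider with branch vertex $u$ and leaves $l_1,\dots,l_k$, labelled so that $d(l_1,u) \leq d(l_2,u) \leq \cdots \leq d(l_k,u)$. Then there exist an independent broadcast $f$ on $T$ of maximum weight and an integer $t$ with $1 \leq t \leq k$ such that $f(l_i) > 0$ for $t \leq i \leq k$ and $f(v) = 0$ for all other vertices $v$. Moreover, for this $f$, if two leaves at the same distance from $u$ are both broadcasting, then all leaves at that distance from $u$ are broadcasting.
   Context: For a graph $G$, $d(u,v)$ is the distance, $\mathrm{ecc}(v)$ the eccentricity, $\mathrm{diam}(G)$ the diameter. A broadcast on $G$ is a function $f: V(G)\to\{0,\dots,\mathrm{diam}(G)\}$ with $f(v)\le\mathrm{ecc}(v)$; its weight is $\sum_v f(v)$. A vertex $v$ is broadcasting if $f(v)>0$; $w$ hears a broadcasting $v$ if $d(w,v)\le f(v)$. A broadcast is independent if every broadcasting vertex hears only itself. A spider ($k\ge3$) is the tree obtained from $K_{1,k}$ by subdividing its edges: it has a branch vertex $u$ of degree $k$ and $k$ leaves, each joined to $u$ by a path, all other vertices having degree $2$. -}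

module Defs where

open import Data.Nat using (ℕ; zero; suc; _+_; _∸_; _⊔_; _≤_; _<_)
open import Data.Fin as Fin using (Fin; toℕ; fromℕ)
open import Data.List using (List; _∷_; []; map; concatMap; foldr; allFin)
open import Data.Nat.ListAction using (sum)
open import Data.Product using (_×_)
open import Relation.Nullary using (does; ¬_)
open import Relation.Binary.PropositionalEquality using (_≡_; _≢_)
open import Data.Bool using (if_then_else_)

-- Leg i (i : Fin k) is a path u - (i,0) - (i,1) - ... - (i, m i)
-- of length suc (m i); its leaf is (i , m i).  The vertex (i , j) is at distance
-- suc j from the branch vertex u.
module Spider (k : ℕ) (m : Fin k → ℕ) where

  data Vertex : Set where
    centre : Vertex
    leg    : (i : Fin k) → Fin (suc (m i)) → Vertex

  leaf : Fin k → Vertex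
  leaf i = leg i (fromℕ (m i))

  vertices : List Vertex
  vertices = centre ∷ concatMap (λ i → map (leg i) (allFin (suc (m i)))) (allFin k)

  absDiff : ℕ → ℕ → ℕ
  absDiff a b = (a ∸ b) + (b ∸ a)

  dist : Vertex → Vertex → ℕ
  dist centre centre = 0
  dist centre (leg i j) = suc (toℕ j)
  dist (leg i j) centre = suc (toℕ j)
  dist (leg i j) (leg i' j') =
    if does (i Fin.≟ i') then absDiff (toℕ j) (toℕ j') else suc (toℕ j) + suc (toℕ j')

  maxList : List ℕ → ℕ
  maxList = foldr _⊔_ 0

  ecc : Vertex → ℕ
  ecc v = maxList (map (dist v) vertices)

  diam : ℕ
  diam = maxList (map ecc vertices)

  IsBroadcast : (Vertex → ℕ) → Set
  IsBroadcast f = (v : Vertex) → f v ≤ ecc v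

  weight : (Vertex → ℕ) → ℕ
  weight f = sum (map f vertices)

  Hears : (Vertex → ℕ) → Vertex → Vertex → Set
  Hears f w v = dist w v ≤ f v

  IsIndependent : (Vertex → ℕ) → Set
  IsIndependent f = (v w : Vertex) → 0 < f v → 0 < f w → Hears f v w → v ≡ w

  IsIndepBroadcast : (Vertex → ℕ) → Set
  IsIndepBroadcast f = IsBroadcast f × IsIndependent f

  IsMaxIndepBroadcast : (Vertex → ℕ) → Set
  IsMaxIndepBroadcast f =
    IsIndepBroadcast f × ((g : Vertex → ℕ) → IsIndepBroadcast g → weight g ≤ weight f)

-- Index the legs in order of nondecreasing length len i = d(l_i, u). For a threshold T < k − 1 let the
-- leaves T, …, k − 1 broadcast as strongly as their mutual independence allows; call its weight Wsum T.
-- These are independent broadcasts, and every independent broadcast g weighs at most some Wsum T, so a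
-- threshold maximising Wsum gives a maximum broadcast. For the bound, let z be a broadcaster nearest the
-- centre, at depth a, and w a nearest broadcaster off the leg of z, at depth b. On a single leg no
-- broadcaster hears a deeper one, so a leg none of whose broadcasters reaches e beyond the centre carries
-- weight at most len + e − 1: the leg of z at most len + b − 1, every other leg at most len + a − 1, and
-- only legs of length ≥ b carry anything. Threshold t or t − 1, for the first leg t of length ≥ b,
-- dominates these bounds. If two broadcasting leaves of equal length had a silent leaf of the same length,
-- the legs around the threshold would have equal lengths and lowering the threshold would raise Wsum.

module Submission where

open import Data.Nat using (ℕ; zero; suc; _+_; _∸_; _⊔_; _≤_; _<_; z≤n; s≤s; s≤s⁻¹; _<?_; _≤?_)
open import Data.Nat.Properties
open import Data.Nat.ListAction using (sum)
open import Data.Nat.ListAction.Properties using (sum-++)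
open import Data.Fin as Fin using (Fin; zero; suc; toℕ; fromℕ; inject₁)
import Data.Fin.Properties as Finₚ
open Finₚ using (toℕ-inject₁; toℕ-fromℕ; toℕ<n; ≤fromℕ; fromℕ≢inject₁)
open import Data.Fin.Relation.Unary.Top using (view; ‵fromℕ; ‵inject₁)
open import Data.List using (List; []; _∷_; _++_; map; concatMap; allFin; tabulate)
open import Data.List.Properties using (map-++; map-∘; map-tabulate; foldr-forcesᵇ; foldr-preservesᵇ)
open import Data.List.Membership.Propositional using (_∈_)
open import Data.List.Membership.Propositional.Properties using (∈-map⁺; ∈-allFin; ∈-concatMap⁺)
open import Data.List.Relation.Unary.Any as Any using (here; there)
import Data.List.Relation.Unary.All as All
import Data.List.Relation.Unary.All.Properties as Allₚ
open import Data.List.Extrema.Nat using (argmax; f[xs]≤f[argmax])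
open import Data.Vec.Functional using (updateAt; replicate)
open import Data.Vec.Functional.Properties using (updateAt-updates; updateAt-minimal)
open import Data.Empty using (⊥)
open import Data.Unit using (⊤; tt)
open import Data.Product using (Σ; ∃-syntax; _×_; _,_; proj₁; proj₂)
import Data.Product as ×
open import Data.Sum using (_⊎_; inj₁; inj₂; map₂)
open import Function using (_∘_; id; const)
open import Relation.Nullary using (¬_; Dec; yes; no; contradiction; _×-dec_)
open import Relation.Unary using (Decidable)
open import Relation.Binary.Definitions using (tri<; tri≈; tri>)
open import Relation.Binary.PropositionalEquality
open import Algebra.Properties.CommutativeSemigroup +-commutativeSemigroup
  using (xy∙z≈xz∙y; xy∙z≈y∙xz)
open import Algebra.Properties.Monoid.Sum +-0-monoid
  using (sum-cong-≗; sum-replicate-zero) renaming (sum to ∑)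
open import Defs

bounded-if-positive : ∀ {x y} → (0 < x → x ≤ y) → x ≤ y
bounded-if-positive {zero}  _ = z≤n
bounded-if-positive {suc x} h = h (s≤s z≤n)

suc-≢ : ∀ {n} {i j : Fin n} → i ≢ j → Fin.suc i ≢ suc j
suc-≢ i≢j = i≢j ∘ Finₚ.suc-injective

∑-mono-≤ : ∀ {n} {a b : Fin n → ℕ} → (∀ j → a j ≤ b j) → ∑ a ≤ ∑ b
∑-mono-≤ {zero}  _   = z≤n
∑-mono-≤ {suc n} a≤b = +-mono-≤ (a≤b zero) (∑-mono-≤ (a≤b ∘ suc))

∑-≤-at : ∀ {n} {a b : Fin n → ℕ} {x y} (i : Fin n) →
         (∀ j → j ≢ i → a j ≤ b j) → a i + x ≤ b i + y → ∑ a + x ≤ ∑ b + y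
∑-≤-at {suc n} {a} {b} {x} {y} zero off at = begin
  a zero + ∑ (a ∘ suc) + x   ≡⟨ xy∙z≈xz∙y (a zero) _ x ⟩
  a zero + x + ∑ (a ∘ suc)   ≤⟨ +-mono-≤ at (∑-mono-≤ (λ j → off (suc j) λ ())) ⟩
  b zero + y + ∑ (b ∘ suc)   ≡⟨ xy∙z≈xz∙y (b zero) _ y ⟨
  b zero + ∑ (b ∘ suc) + y   ∎
  where open ≤-Reasoning
∑-≤-at {suc n} {a} {b} {x} {y} (suc i) off at = begin
  a zero + ∑ (a ∘ suc) + x   ≡⟨ +-assoc (a zero) _ x ⟩
  a zero + (∑ (a ∘ suc) + x) ≤⟨ +-mono-≤ (off zero λ ()) (∑-≤-at i (λ j → off (suc j) ∘ suc-≢) at) ⟩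
  b zero + (∑ (b ∘ suc) + y) ≡⟨ +-assoc (b zero) _ y ⟨
  b zero + ∑ (b ∘ suc) + y   ∎
  where open ≤-Reasoning

∑-≤-exchange : ∀ {n} {a b : Fin n → ℕ} {y} {i i′ : Fin n} → i ≢ i′ →
               (∀ j → j ≢ i → j ≢ i′ → a j ≤ b j) →
               a i + a i′ + y ≤ b i + b i′ → ∑ a + y ≤ ∑ b
∑-≤-exchange {i = zero}  {zero}   i≢i′ _ _ = contradiction refl i≢i′
∑-≤-exchange {suc n} {a} {b} {y} {zero} {suc i′} _ off pair = begin
  a zero + ∑ (a ∘ suc) + y   ≡⟨ xy∙z≈y∙xz (a zero) _ y ⟩
  ∑ (a ∘ suc) + (a zero + y) ≤⟨ ∑-≤-at i′ (λ j → off (suc j) (λ ()) ∘ suc-≢) tail-pair ⟩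
  ∑ (b ∘ suc) + b zero       ≡⟨ +-comm _ (b zero) ⟩
  b zero + ∑ (b ∘ suc)       ∎
  where
  open ≤-Reasoning
  tail-pair : a (suc i′) + (a zero + y) ≤ b (suc i′) + b zero
  tail-pair = begin
    a (suc i′) + (a zero + y) ≡⟨ +-assoc (a (suc i′)) _ y ⟨
    a (suc i′) + a zero + y   ≡⟨ cong (_+ y) (+-comm (a (suc i′)) _) ⟩
    a zero + a (suc i′) + y   ≤⟨ pair ⟩
    b zero + b (suc i′)       ≡⟨ +-comm (b zero) _ ⟩
    b (suc i′) + b zero       ∎
∑-≤-exchange {suc n} {a} {b} {y} {suc i} {zero} i≢i′ off pair =
  ∑-≤-exchange {a = a} {b} {y} {zero} {suc i} (i≢i′ ∘ sym) (λ j j≢0 j≢i → off j j≢i j≢0)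
    (subst₂ _≤_ (cong (_+ y) (+-comm (a (suc i)) _)) (+-comm (b (suc i)) _) pair)
∑-≤-exchange {suc n} {a} {b} {y} {suc i} {suc i′} i≢i′ off pair = begin
  a zero + ∑ (a ∘ suc) + y   ≡⟨ +-assoc (a zero) _ y ⟩
  a zero + (∑ (a ∘ suc) + y) ≤⟨ +-mono-≤ (off zero (λ ()) (λ ()))
                                  (∑-≤-exchange (i≢i′ ∘ cong suc)
                                    (λ j j≢i j≢i′ → off (suc j) (suc-≢ j≢i) (suc-≢ j≢i′))
                                    pair) ⟩
  b zero + ∑ (b ∘ suc)       ∎
  where open ≤-Reasoning

∑-zero : ∀ {n} {a : Fin n → ℕ} → (∀ j → a j ≡ 0) → ∑ a ≡ 0
∑-zero {n} a≡0 = trans (sum-cong-≗ a≡0) (sum-replicate-zero n)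

∑-concentrated : ∀ {n} {a : Fin n → ℕ} (i : Fin n) → (∀ j → j ≢ i → a j ≡ 0) → ∑ a ≡ a i
∑-concentrated {suc n} {a} zero    off =
  trans (cong (a zero +_) (∑-zero (λ j → off (suc j) λ ()))) (+-identityʳ (a zero))
∑-concentrated {suc n} {a} (suc i) off =
  trans (cong (_+ ∑ (a ∘ suc)) (off zero λ ()))
        (∑-concentrated i (λ j j≢i → off (suc j) (suc-≢ j≢i)))

∑-pair-≤ : ∀ {n} {a : Fin n → ℕ} {i i′ : Fin n} → i ≢ i′ → a i + a i′ ≤ ∑ a
∑-pair-≤ {n} {a} {i} {i′} i≢i′ =
  subst (_≤ ∑ a) (cong (_+ (a i + a i′)) (∑-zero {n} (λ _ → refl)))
    (∑-≤-exchange {a = λ _ → 0} i≢i′ (λ _ _ _ → z≤n) ≤-refl)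

∑-zero-or-positive : ∀ {n} (a : Fin n → ℕ) → ∑ a ≡ 0 ⊎ ∃[ j ] 0 < a j
∑-zero-or-positive {zero}  a = inj₁ refl
∑-zero-or-positive {suc n} a with a zero in eq | ∑-zero-or-positive (a ∘ suc)
... | suc _ | _              = inj₂ (zero , subst (0 <_) (sym eq) (s≤s z≤n))
... | zero  | inj₁ tail≡0    = inj₁ tail≡0
... | zero  | inj₂ (j , pos) = inj₂ (suc j , pos)

-- h p is the strength of vertex p = 0 … n − 1 of a path hanging from a vertex o, vertex p being at
-- distance p + 1 from o; OutwardUnheard h says no broadcasting vertex hears one further from o.
OutwardUnheard : ∀ {n} → (Fin n → ℕ) → Set
OutwardUnheard h = ∀ p q → p Fin.< q → 0 < h p → 0 < h q → toℕ p + h q < toℕ q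

outwardUnheard-tail : ∀ {n} {h : Fin (suc n) → ℕ} → OutwardUnheard h → OutwardUnheard (h ∘ suc)
outwardUnheard-tail unheard p q p<q hp hq = s≤s⁻¹ (unheard (suc p) (suc q) (s≤s p<q) hp hq)

-- The bound h p ≤ p + e says that no vertex reaches the vertex at distance e beyond o.
path-∑-≤ : ∀ n e (h : Fin (suc n) → ℕ) → OutwardUnheard h →
           (∀ p → 0 < h p → h p ≤ toℕ p + e) → ∑ h ≤ n + e
path-∑-≤ zero    e h _       reach = subst (_≤ e) (sym (+-identityʳ (h zero))) (bounded-if-positive (reach zero))
path-∑-≤ (suc n) e h unheard reach with h zero in eq
... | zero  = subst (∑ (h ∘ suc) ≤_) (+-suc n e)
                (path-∑-≤ n (suc e) (h ∘ suc) (outwardUnheard-tail unheard)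
                  (λ p pos → subst (h (suc p) ≤_) (sym (+-suc (toℕ p) e)) (reach (suc p) pos)))
... | suc x = begin
  suc x + ∑ (h ∘ suc) ≤⟨ +-mono-≤ (subst (_≤ e) eq (reach zero h₀>0))
                                 (path-∑-≤ n 0 (h ∘ suc) (outwardUnheard-tail unheard) reach-tail) ⟩
  e + (n + 0)         ≡⟨ cong (e +_) (+-identityʳ n) ⟩
  e + n               ≡⟨ +-comm e n ⟩
  n + e               ≤⟨ n≤1+n _ ⟩
  suc n + e           ∎
  where
  open ≤-Reasoning
  h₀>0 : 0 < h zero
  h₀>0 = subst (0 <_) (sym eq) (s≤s z≤n)
  reach-tail : ∀ q → 0 < h (suc q) → h (suc q) ≤ toℕ q + 0
  reach-tail q hq = subst (h (suc q) ≤_) (sym (+-identityʳ (toℕ q)))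
                      (s≤s⁻¹ (unheard zero (suc q) (s≤s z≤n) h₀>0 hq))

record Least {A : Set} (P : A → Set) (μ : A → ℕ) (xs : List A) : Set where
  constructor least
  field
    elem    : A
    holds   : P elem
    minimal : ∀ {x} → x ∈ xs → P x → μ elem ≤ μ x

least? : ∀ {A : Set} {P : A → Set} → Decidable P → (μ : A → ℕ) → (xs : List A) →
         (∀ {x} → x ∈ xs → ¬ P x) ⊎ Least P μ xs
least? P? μ [] = inj₁ λ ()
least? P? μ (x ∷ xs) with P? x | least? P? μ xs
... | no ¬px | inj₁ none = inj₁ λ { (here refl) → ¬px ; (there x∈) → none x∈ }
... | no ¬px | inj₂ (least z pz min) =
  inj₂ (least z pz λ { (here refl) px → contradiction px ¬px ; (there x∈) → min x∈ })
... | yes px | inj₁ none =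
  inj₂ (least x px λ { (here refl) _ → ≤-refl ; (there x∈) py → contradiction py (none x∈) })
... | yes px | inj₂ (least z pz min) with μ x ≤? μ z
...   | yes x≤z = inj₂ (least x px λ { (here refl) _ → ≤-refl ; (there x∈) py → ≤-trans x≤z (min x∈ py) })
...   | no  x≰z = inj₂ (least z pz λ { (here refl) _ → <⇒≤ (≰⇒> x≰z) ; (there x∈) → min x∈ })

sum-map-concatMap : ∀ {A B : Set} (g : B → ℕ) (F : A → List B) (xs : List A) →
                    sum (map g (concatMap F xs)) ≡ sum (map (sum ∘ map g ∘ F) xs)
sum-map-concatMap g F []       = refl
sum-map-concatMap g F (x ∷ xs) = begin
  sum (map g (F x ++ concatMap F xs))           ≡⟨ cong sum (map-++ g (F x) _) ⟩
  sum (map g (F x) ++ map g (concatMap F xs))   ≡⟨ sum-++ (map g (F x)) _ ⟩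
  sum (map g (F x)) + sum (map g (concatMap F xs))        ≡⟨ cong (sum (map g (F x)) +_) (sum-map-concatMap g F xs) ⟩
  sum (map g (F x)) + sum (map (sum ∘ map g ∘ F) xs)      ∎
  where open ≡-Reasoning

sum-map-allFin : ∀ n (h : Fin n → ℕ) → sum (map h (allFin n)) ≡ ∑ h
sum-map-allFin zero    h = refl
sum-map-allFin (suc n) h = cong (h zero +_) (begin
  sum (map h (tabulate suc))        ≡⟨ cong sum (map-tabulate suc h) ⟩
  sum (tabulate (h ∘ suc))          ≡⟨ cong sum (map-tabulate id (h ∘ suc)) ⟨
  sum (map (h ∘ suc) (allFin n))    ≡⟨ sum-map-allFin n (h ∘ suc) ⟩
  ∑ (h ∘ suc)                       ∎)
  where open ≡-Reasoning

module SpiderGeometry {k : ℕ} (m : Fin k → ℕ) where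
  open Spider k m

  len : Fin k → ℕ
  len i = suc (m i)

  depth : Vertex → ℕ
  depth centre    = 0
  depth (leg _ p) = suc (toℕ p)

  OffLeg : Fin k → Vertex → Set
  OffLeg i centre    = ⊤
  OffLeg i (leg j _) = i ≢ j

  IsLeg : Vertex → Set
  IsLeg centre    = ⊥
  IsLeg (leg _ _) = ⊤

  isLeg? : Decidable IsLeg
  isLeg? centre    = no λ ()
  isLeg? (leg _ _) = yes tt

  offLeg? : ∀ i → Decidable (OffLeg i)
  offLeg? i centre    = yes tt
  offLeg? i (leg j _) with i Fin.≟ j
  ... | yes i≡j = no λ i≢j → i≢j i≡j
  ... | no  i≢j = yes i≢j

  dist-other-legs : ∀ {i j} (p : Fin (len i)) (q : Fin (len j)) → i ≢ j →
                    dist (leg i p) (leg j q) ≡ suc (toℕ p) + suc (toℕ q)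
  dist-other-legs {i} {j} p q i≢j with i Fin.≟ j
  ... | yes i≡j = contradiction i≡j i≢j
  ... | no  _   = refl

  dist-along-leg : ∀ {i} (p q : Fin (len i)) → toℕ p ≤ toℕ q →
                   toℕ p + dist (leg i p) (leg i q) ≡ toℕ q
  dist-along-leg {i} p q p≤q with i Fin.≟ i
  ... | no  i≢i = contradiction refl i≢i
  ... | yes _   = begin
    toℕ p + ((toℕ p ∸ toℕ q) + (toℕ q ∸ toℕ p)) ≡⟨ cong (λ d → toℕ p + (d + (toℕ q ∸ toℕ p)))
                                                         (m≤n⇒m∸n≡0 p≤q) ⟩
    toℕ p + (toℕ q ∸ toℕ p)                     ≡⟨ m+[n∸m]≡n p≤q ⟩
    toℕ q                                       ∎
    where open ≡-Reasoning

  dist-from-offLeg : ∀ {i v} (p : Fin (len i)) → OffLeg i v → dist v (leg i p) ≡ depth v + suc (toℕ p)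
  dist-from-offLeg {v = centre}    p _   = refl
  dist-from-offLeg {v = leg j q}   p i≢j = dist-other-legs q p (i≢j ∘ sym)

  legVertices : Fin k → List Vertex
  legVertices i = map (leg i) (allFin (len i))

  dist-leaves : ∀ {i j} → i ≢ j → dist (leaf i) (leaf j) ≡ len i + len j
  dist-leaves {i} {j} i≢j =
    trans (dist-other-legs (fromℕ (m i)) (fromℕ (m j)) i≢j)
          (cong₂ (λ a b → suc a + suc b) (toℕ-fromℕ (m i)) (toℕ-fromℕ (m j)))

  ∈-vertices : ∀ v → v ∈ vertices
  ∈-vertices centre    = here refl
  ∈-vertices (leg i p) =
    there (∈-concatMap⁺ legVertices (Any.map (λ { refl → ∈-map⁺ (leg i) (∈-allFin p) }) (∈-allFin i)))

  dist-≤-ecc : ∀ v w → dist v w ≤ ecc v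
  dist-≤-ecc v w = All.lookup (Allₚ.map⁻ (foldr-forcesᵇ ⊔-forces 0 _ ≤-refl)) (∈-vertices w)
    where
    ⊔-forces : ∀ x y → x ⊔ y ≤ ecc v → x ≤ ecc v × y ≤ ecc v
    ⊔-forces x y le = m⊔n≤o⇒m≤o x y le , m⊔n≤o⇒n≤o x y le

  ecc-≤ : ∀ v {B} → (∀ w → dist v w ≤ B) → ecc v ≤ B
  ecc-≤ v {B} bound = foldr-preservesᵇ {P = _≤ B} ⊔-lub z≤n (Allₚ.map⁺ (All.universal bound vertices))

  legWeight : (Vertex → ℕ) → Fin k → ℕ
  legWeight g i = ∑ (g ∘ leg i)

  weight≡centre+legs : ∀ g → weight g ≡ g centre + ∑ (legWeight g)
  weight≡centre+legs g = cong (g centre +_) (begin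
    sum (map g (concatMap legVertices (allFin k)))           ≡⟨ sum-map-concatMap g legVertices (allFin k) ⟩
    sum (map (sum ∘ map g ∘ legVertices) (allFin k))         ≡⟨ sum-map-allFin k _ ⟩
    ∑ (sum ∘ map g ∘ legVertices)                             ≡⟨ sum-cong-≗ on-leg ⟩
    ∑ (legWeight g)                                           ∎)
    where
    open ≡-Reasoning
    on-leg : ∀ i → sum (map g (legVertices i)) ≡ legWeight g i
    on-leg i = trans (cong sum (sym (map-∘ (allFin (len i))))) (sum-map-allFin (len i) (g ∘ leg i))

  module _ {g : Vertex → ℕ} (indep : IsIndependent g) where

    separated : ∀ {v w} → 0 < g v → 0 < g w → v ≢ w → g w < dist v w
    separated gv gw v≢w = ≰⇒> λ v-hears-w → v≢w (indep _ _ gv gw v-hears-w)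

    legWeight-≤-reach : ∀ i e → (∀ p → 0 < g (leg i p) → g (leg i p) ≤ toℕ p + e) →
                        legWeight g i ≤ m i + e
    legWeight-≤-reach i e = path-∑-≤ (m i) e (g ∘ leg i) unheard
      where
      unheard : OutwardUnheard (g ∘ leg i)
      unheard p q p<q gp gq =
        subst (toℕ p + g (leg i q) <_) (dist-along-leg p q (<⇒≤ p<q))
          (+-monoʳ-< (toℕ p) (separated gp gq λ { refl → <-irrefl refl p<q }))

    legWeight-≤ : ∀ {i y} → 0 < g y → OffLeg i y → legWeight g i ≤ m i + depth y
    legWeight-≤ {i} {y} gy off = legWeight-≤-reach i (depth y) reach
      where
      apart : ∀ {y p} → OffLeg i y → y ≢ leg i p
      apart {centre}  _   ()
      apart {leg j q} i≢j refl = i≢j refl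
      reach : ∀ p → 0 < g (leg i p) → g (leg i p) ≤ toℕ p + depth y
      reach p gp = begin
        g (leg i p)     ≤⟨ s≤s⁻¹ (subst (g (leg i p) <_) far (separated gy gp (apart off))) ⟩
        depth y + toℕ p ≡⟨ +-comm (depth y) (toℕ p) ⟩
        toℕ p + depth y ∎
        where
        open ≤-Reasoning
        far : dist y (leg i p) ≡ suc (depth y + toℕ p)
        far = trans (dist-from-offLeg p off) (+-suc (depth y) (toℕ p))

inject₁<suc : ∀ {n} (i : Fin n) → inject₁ i Fin.< suc i
inject₁<suc i = Finₚ.≤̄⇒inject₁< Finₚ.≤-refl

inject₁<⇒suc≤ : ∀ {n} {i : Fin n} {j : Fin (suc n)} → inject₁ i Fin.< j → suc i Fin.≤ j
inject₁<⇒suc≤ {i = i} {j} lt = subst (λ x → suc x ≤ toℕ j) (toℕ-inject₁ i) lt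

module SortedSpider (n : ℕ) (m : Fin (suc (suc n)) → ℕ) (sorted : ∀ i j → i Fin.≤ j → m i ≤ m j) where

  open Spider (suc (suc n)) m
  open SpiderGeometry m

  len-mono : ∀ {i j} → i Fin.≤ j → len i ≤ len j
  len-mono i≤j = s≤s (sorted _ _ i≤j)

  last : Fin (suc (suc n))
  last = fromℕ (suc n)

  lenMax : ℕ
  lenMax = len last

  len-≤-max : ∀ i → len i ≤ lenMax
  len-≤-max i = len-mono (≤fromℕ i)

  ecc-≤-depth+max : ∀ v → ecc v ≤ depth v + lenMax
  ecc-≤-depth+max v = ecc-≤ v (bound v)
    where
    on-leg : ∀ {i} (q : Fin (len i)) → suc (toℕ q) ≤ lenMax
    on-leg {i} q = ≤-trans (toℕ<n q) (len-≤-max i)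
    bound : ∀ v w → dist v w ≤ depth v + lenMax
    bound centre    centre    = z≤n
    bound centre    (leg j q) = on-leg q
    bound (leg i p) centre    = m≤m+n _ _
    bound (leg i p) (leg j q) with i Fin.≟ j
    ... | yes refl = +-mono-≤ (≤-trans (m∸n≤m (toℕ p) (toℕ q)) (n≤1+n (toℕ p)))
                              (≤-trans (m∸n≤m (toℕ q) (toℕ p)) (<⇒≤ (on-leg q)))
    ... | no  _    = +-monoʳ-≤ (suc (toℕ p)) (on-leg q)

  -- The broadcasts of the theorem, for a threshold T < k − 1: leaves below T are silent, leaf T broadcasts
  -- with strength len T + len (T + 1) − 1 and every later leaf j with len j + len T − 1, the largest
  -- strengths that keep all these leaves out of each other's reach.
  candidate : Fin (suc n) → Fin (suc (suc n)) → ℕ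
  candidate T j with Finₚ.<-cmp j (inject₁ T)
  ... | tri< _ _ _ = 0
  ... | tri≈ _ _ _ = m j + len (suc T)
  ... | tri> _ _ _ = m j + len (inject₁ T)

  Wsum : Fin (suc n) → ℕ
  Wsum T = ∑ (candidate T)

  candidate-below : ∀ {T j} → j Fin.< inject₁ T → candidate T j ≡ 0
  candidate-below {T} {j} j<T with Finₚ.<-cmp j (inject₁ T)
  ... | tri< _ _ _   = refl
  ... | tri≈ ¬< _ _  = contradiction j<T ¬<
  ... | tri> ¬< _ _  = contradiction j<T ¬<

  candidate-at : ∀ T → candidate T (inject₁ T) ≡ m (inject₁ T) + len (suc T)
  candidate-at T with Finₚ.<-cmp (inject₁ T) (inject₁ T)
  ... | tri< _ ¬≡ _ = contradiction refl ¬≡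
  ... | tri≈ _ _ _  = refl
  ... | tri> _ ¬≡ _ = contradiction refl ¬≡

  candidate-above : ∀ {T j} → inject₁ T Fin.< j → candidate T j ≡ m j + len (inject₁ T)
  candidate-above {T} {j} T<j with Finₚ.<-cmp j (inject₁ T)
  ... | tri< _ _ ¬>  = contradiction T<j ¬>
  ... | tri≈ _ _ ¬>  = contradiction T<j ¬>
  ... | tri> _ _ _   = refl

  candidate-≤ : ∀ T j → candidate T j ≤ m j + len (suc T)
  candidate-≤ T j with Finₚ.<-cmp j (inject₁ T)
  ... | tri< _ _ _ = z≤n
  ... | tri≈ _ _ _ = ≤-refl
  ... | tri> _ _ _ = +-monoʳ-≤ (m j) (len-mono (<⇒≤ (inject₁<suc T)))

  candidate-≥ : ∀ {T j} → inject₁ T Fin.≤ j → m j + len (inject₁ T) ≤ candidate T j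
  candidate-≥ {T} {j} T≤j with Finₚ.<-cmp j (inject₁ T)
  ... | tri< j<T _ _ = contradiction T≤j (<⇒≱ j<T)
  ... | tri≈ _ _ _   = +-monoʳ-≤ (m j) (len-mono (<⇒≤ (inject₁<suc T)))
  ... | tri> _ _ _   = ≤-refl

  candidate-<-len : ∀ {T i j} → inject₁ T Fin.≤ i → i ≢ j → candidate T j < len j + len i
  candidate-<-len {T} {i} {j} T≤i i≢j with Finₚ.<-cmp j (inject₁ T)
  ... | tri< _ _ _     = s≤s z≤n
  ... | tri≈ _ refl _  = s≤s (+-monoʳ-≤ (m j) (len-mono (inject₁<⇒suc≤ (Finₚ.≤∧≢⇒< T≤i (i≢j ∘ sym)))))
  ... | tri> _ _ _     = s≤s (+-monoʳ-≤ (m j) (len-mono T≤i))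

  candidate-positive : ∀ {T j} → 0 < candidate T j → inject₁ T Fin.≤ j
  candidate-positive {T} {j} pos with Finₚ.<-cmp j (inject₁ T)
  ... | tri< _ _ _     = contradiction pos (<-irrefl refl)
  ... | tri≈ _ refl _  = Finₚ.≤-refl
  ... | tri> _ _ T<j   = <⇒≤ T<j

  single-leg-≤-Wsum : ∀ {x : Fin (suc (suc n)) → ℕ} {y} i → (∀ j → j ≢ i → x j ≡ 0) →
                      x i + y ≤ m i + suc lenMax → ∑ x + y ≤ Wsum (fromℕ n)
  single-leg-≤-Wsum {x} {y} i others≡0 home = begin
    ∑ x + y                             ≡⟨ cong (_+ y) (∑-concentrated i others≡0) ⟩
    x i + y                             ≤⟨ home ⟩
    m i + suc lenMax                    ≤⟨ +-mono-≤ (sorted i last (≤fromℕ i)) room ⟩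
    m last + (len T₀ + (m T₀ + lenMax)) ≡⟨ +-assoc (m last) _ _ ⟨
    (m last + len T₀) + (m T₀ + lenMax) ≡⟨ cong₂ _+_ (candidate-above (inject₁<suc T)) (candidate-at T) ⟨
    candidate T last + candidate T T₀   ≤⟨ ∑-pair-≤ {a = candidate T} (fromℕ≢inject₁ {i = T}) ⟩
    Wsum T                              ∎
    where
    open ≤-Reasoning
    T : Fin (suc n)
    T = fromℕ n
    T₀ : Fin (suc (suc n))
    T₀ = inject₁ T
    room : suc lenMax ≤ len T₀ + (m T₀ + lenMax)
    room = s≤s (≤-trans (m≤n+m lenMax (m T₀)) (m≤n+m _ (m T₀)))

  -- What the upper bound uses of an independent broadcast with leg weights x and centre weight y: a
  -- broadcaster z nearest the centre has depth near, a broadcasting leg vertex w nearest the centre among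
  -- those off the leg of z (all leg vertices if z is the centre) has depth far, and home is the leg of z,
  -- or of w if z is the centre.
  record Profile (x : Fin (suc (suc n)) → ℕ) (y : ℕ) : Set where
    field
      home      : Fin (suc (suc n))
      near far  : ℕ
      near≤far  : near ≤ far
      near≤len  : near ≤ len home
      far-leg   : Σ (Fin (suc (suc n))) λ j → far ≤ len j
      home-≤    : x home + y ≤ m home + far
      away      : ∀ j → j ≢ home → x j ≡ 0 ⊎ (far ≤ len j × x j ≤ m j + near)

  module _ {x : Fin (suc (suc n)) → ℕ} {y : ℕ} (P : Profile x y) where
    open Profile P

    private
      BelowLongLegs : Fin (suc (suc n)) → Set
      BelowLongLegs t = ∀ j → far ≤ len j → t Fin.≤ j

      Dominated : Fin (suc n) → Fin (suc (suc n)) → Set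
      Dominated T j = inject₁ T Fin.≤ j × x j ≤ m j + len (inject₁ T)

      away-from : ∀ {t} → BelowLongLegs t → ∀ j → j ≢ home → x j ≡ 0 ⊎ (t Fin.≤ j × x j ≤ m j + near)
      away-from t-least j j≢home = map₂ (λ (far≤j , bound) → t-least j far≤j , bound) (away j j≢home)

      ≤-candidate : ∀ T j → x j ≡ 0 ⊎ Dominated T j → x j ≤ candidate T j
      ≤-candidate T j (inj₁ x≡0)           = subst (_≤ candidate T j) (sym x≡0) z≤n
      ≤-candidate T j (inj₂ (T≤j , bound)) = ≤-trans bound (candidate-≥ T≤j)

      threshold-≤-home : ∀ t → far ≤ len t → BelowLongLegs t → t Fin.≤ home → ∃[ T ] ∑ x + y ≤ Wsum T
      threshold-≤-home t far≤t t-least t≤home with view t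
      ... | ‵fromℕ = fromℕ n , single-leg-≤-Wsum home others≡0
                       (≤-trans home-≤ (+-monoʳ-≤ (m home) (≤-trans far≤t (n≤1+n lenMax))))
        where
        home≡last : home ≡ last
        home≡last = Finₚ.≤-antisym (≤fromℕ home) t≤home
        others≡0 : ∀ j → j ≢ home → x j ≡ 0
        others≡0 j j≢home with away-from t-least j j≢home
        ... | inj₁ x≡0          = x≡0
        ... | inj₂ (last≤j , _) =
          contradiction (trans (Finₚ.≤-antisym (≤fromℕ j) last≤j) (sym home≡last)) j≢home
      ... | ‵inject₁ T = T , subst (∑ x + y ≤_) (+-identityʳ (Wsum T)) (∑-≤-at home off at)
        where
        widen : ∀ {j} → inject₁ T Fin.≤ j × x j ≤ m j + near → Dominated T j
        widen {j} (T≤j , bound) = T≤j , ≤-trans bound (+-monoʳ-≤ (m j) (≤-trans near≤far far≤t))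
        off : ∀ j → j ≢ home → x j ≤ candidate T j
        off j j≢home = ≤-candidate T j (map₂ widen (away-from t-least j j≢home))
        at : x home + y ≤ candidate T home + 0
        at = begin
          x home + y               ≤⟨ home-≤ ⟩
          m home + far             ≤⟨ +-monoʳ-≤ (m home) far≤t ⟩
          m home + len (inject₁ T) ≤⟨ candidate-≥ t≤home ⟩
          candidate T home         ≡⟨ +-identityʳ _ ⟨
          candidate T home + 0     ∎
          where open ≤-Reasoning

      home-<-threshold : ∀ t → far ≤ len t → BelowLongLegs t → home Fin.< t → ∃[ T ] ∑ x + y ≤ Wsum T
      home-<-threshold (suc T) far≤t t-least home<t = T , bound
        where
        home≤T : home Fin.≤ inject₁ T
        home≤T = subst (toℕ home ≤_) (sym (toℕ-inject₁ T)) (s≤s⁻¹ home<t)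
        shift : ∀ {j} → suc T Fin.≤ j × x j ≤ m j + near → Dominated T j
        shift {j} (T<j , bound) =
          subst (_≤ toℕ j) (sym (toℕ-inject₁ T)) (<⇒≤ T<j) ,
          ≤-trans bound (+-monoʳ-≤ (m j) (≤-trans near≤len (len-mono home≤T)))
        off : ∀ j → j ≢ home → x j ≤ candidate T j
        off j j≢home = ≤-candidate T j (map₂ shift (away-from t-least j j≢home))
        to-T : x home + y ≤ candidate T (inject₁ T)
        to-T = begin
          x home + y                  ≤⟨ home-≤ ⟩
          m home + far                ≤⟨ +-mono-≤ (sorted home (inject₁ T) home≤T) far≤t ⟩
          m (inject₁ T) + len (suc T) ≡⟨ candidate-at T ⟨
          candidate T (inject₁ T)     ∎
          where open ≤-Reasoning
        bound : ∑ x + y ≤ Wsum T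
        bound with home Fin.≟ inject₁ T
        ... | yes home≡T = subst (∑ x + y ≤_) (+-identityʳ (Wsum T))
                             (∑-≤-at home off (subst (λ i → x home + y ≤ candidate T i + 0) (sym home≡T)
                                                 (≤-trans to-T (≤-reflexive (sym (+-identityʳ _))))))
        ... | no  home≢T = ∑-≤-exchange home≢T (λ j j≢home _ → off j j≢home) (begin
          x home + x (inject₁ T) + y                 ≡⟨ cong (λ z → x home + z + y) T-empty ⟩
          x home + 0 + y                             ≡⟨ cong (_+ y) (+-identityʳ (x home)) ⟩
          x home + y                                 ≤⟨ to-T ⟩
          candidate T (inject₁ T)                    ≤⟨ m≤n+m _ (candidate T home) ⟩
          candidate T home + candidate T (inject₁ T) ∎)
          where
          open ≤-Reasoning
          T-empty : x (inject₁ T) ≡ 0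
          T-empty with away-from t-least (inject₁ T) (home≢T ∘ sym)
          ... | inj₁ x≡0     = x≡0
          ... | inj₂ (T<T , _) = contradiction (subst (suc (toℕ T) ≤_) (toℕ-inject₁ T) T<T) (<-irrefl refl)

    profile-≤-Wsum : ∃[ T ] ∑ x + y ≤ Wsum T
    profile-≤-Wsum with least? (λ j → far ≤? len j) toℕ (allFin (suc (suc n)))
    ... | inj₁ none = contradiction (proj₂ far-leg) (none (∈-allFin (proj₁ far-leg)))
    ... | inj₂ (least t far≤t t-least) with toℕ t ≤? toℕ home
    ...   | yes t≤home = threshold-≤-home t far≤t (λ j → t-least (∈-allFin j)) t≤home
    ...   | no  t≰home = home-<-threshold t far≤t (λ j → t-least (∈-allFin j)) (≰⇒> t≰home)

  module _ {g : Vertex → ℕ} (bcast : IsBroadcast g) (indep : IsIndependent g) where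

    private
      silent : ∀ {v} → ¬ 0 < g v → g v ≡ 0
      silent ¬pos = n≤0⇒n≡0 (≮⇒≥ ¬pos)

      legWeight-≡0⊎ : ∀ i → legWeight g i ≡ 0 ⊎ ∃[ p ] 0 < g (leg i p)
      legWeight-≡0⊎ i = ∑-zero-or-positive (g ∘ leg i)

      silent-legs : ∀ i → (∀ p → ¬ 0 < g (leg i p)) → legWeight g i ≡ 0
      silent-legs i none = ∑-zero λ p → silent (none p)

      centre-broadcasts : 0 < g centre → ∃[ T ] ∑ (legWeight g) + g centre ≤ Wsum T
      centre-broadcasts c>0 with least? (λ v → (0 <? g v) ×-dec isLeg? v) depth vertices
      ... | inj₁ none = fromℕ n , single-leg-≤-Wsum last (λ j _ → legs≡0 j) (begin
        legWeight g last + g centre ≡⟨ cong (_+ g centre) (legs≡0 last) ⟩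
        g centre                    ≤⟨ ≤-trans (bcast centre) (ecc-≤-depth+max centre) ⟩
        lenMax                      ≤⟨ m≤n+m lenMax (m last) ⟩
        m last + lenMax             ≤⟨ +-monoʳ-≤ (m last) (n≤1+n lenMax) ⟩
        m last + suc lenMax         ∎)
        where
        open ≤-Reasoning
        legs≡0 : ∀ j → legWeight g j ≡ 0
        legs≡0 j = silent-legs j λ p pos → none (∈-vertices (leg j p)) (pos , tt)
      ... | inj₂ (least centre (_ , ()) _)
      ... | inj₂ (least (leg j q) (w>0 , _) w-least) = profile-≤-Wsum {x = legWeight g} (record
        { home     = j
        ; near     = 0
        ; far      = suc (toℕ q)
        ; near≤far = z≤n
        ; near≤len = z≤n
        ; far-leg  = j , toℕ<n q
        ; home-≤   = subst (legWeight g j + g centre ≤_) (cong (_+ suc (toℕ q)) (+-identityʳ (m j)))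
                       (+-mono-≤ (legs-≤ j) (<⇒≤ (separated indep w>0 c>0 λ ())))
        ; away     = λ j′ _ → map₂ long-and-light (legWeight-≡0⊎ j′)
        })
        where
        legs-≤ : ∀ i → legWeight g i ≤ m i + 0
        legs-≤ i = legWeight-≤ indep c>0 tt
        long-and-light : ∀ {j′} → ∃[ p ] 0 < g (leg j′ p) → suc (toℕ q) ≤ len j′ × legWeight g j′ ≤ m j′ + 0
        long-and-light {j′} (p , pos) = ≤-trans (w-least (∈-vertices (leg j′ p)) (pos , tt)) (toℕ<n p) , legs-≤ j′

      one-leg-broadcasts : ∀ i → g centre ≡ 0 → (∀ j → j ≢ i → legWeight g j ≡ 0) →
                           ∃[ T ] ∑ (legWeight g) + g centre ≤ Wsum T
      one-leg-broadcasts i centre≡0 others≡0 = fromℕ n , single-leg-≤-Wsum i others≡0 (begin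
        legWeight g i + g centre ≡⟨ cong (legWeight g i +_) centre≡0 ⟩
        legWeight g i + 0        ≡⟨ +-identityʳ _ ⟩
        legWeight g i            ≤⟨ legWeight-≤-reach indep i (suc lenMax) reach ⟩
        m i + suc lenMax         ∎)
        where
        open ≤-Reasoning
        reach : ∀ q → 0 < g (leg i q) → g (leg i q) ≤ toℕ q + suc lenMax
        reach q _ = ≤-trans (bcast (leg i q))
                      (≤-trans (ecc-≤-depth+max (leg i q)) (≤-reflexive (sym (+-suc (toℕ q) lenMax))))

      leg-broadcasts-first : ∀ i p → 0 < g (leg i p) →
                             (∀ {v} → v ∈ vertices → 0 < g v → suc (toℕ p) ≤ depth v) →
                             ∃[ T ] ∑ (legWeight g) + g centre ≤ Wsum T
      leg-broadcasts-first i p z>0 z-least = bound (least? (λ v → (0 <? g v) ×-dec offLeg? i v) depth vertices)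
        where
        OffBroadcaster : Vertex → Set
        OffBroadcaster v = 0 < g v × OffLeg i v
        centre≡0 : g centre ≡ 0
        centre≡0 = silent λ c>0 → contradiction (z-least (∈-vertices centre) c>0) λ ()
        bound : (∀ {v} → v ∈ vertices → ¬ OffBroadcaster v) ⊎ Least OffBroadcaster depth vertices →
                ∃[ T ] ∑ (legWeight g) + g centre ≤ Wsum T
        bound (inj₁ none) = one-leg-broadcasts i centre≡0
                              λ j j≢i → silent-legs j λ q pos → none (∈-vertices (leg j q)) (pos , j≢i ∘ sym)
        bound (inj₂ (least centre (w>0 , _) _)) = contradiction (z-least (∈-vertices centre) w>0) λ ()
        bound (inj₂ (least (leg j q) (w>0 , i≢j) w-least)) = profile-≤-Wsum {x = legWeight g} (record
          { home     = i
          ; near     = suc (toℕ p)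
          ; far      = suc (toℕ q)
          ; near≤far = z-least (∈-vertices (leg j q)) w>0
          ; near≤len = toℕ<n p
          ; far-leg  = j , toℕ<n q
          ; home-≤   = subst (λ c → legWeight g i + c ≤ m i + suc (toℕ q)) (sym centre≡0)
                         (subst (_≤ m i + suc (toℕ q)) (sym (+-identityʳ _)) (legWeight-≤ indep w>0 i≢j))
          ; away     = λ j′ j′≢i → map₂ (long-and-light j′≢i) (legWeight-≡0⊎ j′)
          })
          where
          long-and-light : ∀ {j′} → j′ ≢ i → ∃[ p′ ] 0 < g (leg j′ p′) →
                           suc (toℕ q) ≤ len j′ × legWeight g j′ ≤ m j′ + suc (toℕ p)
          long-and-light {j′} j′≢i (p′ , pos) =
            ≤-trans (w-least (∈-vertices (leg j′ p′)) (pos , j′≢i ∘ sym)) (toℕ<n p′) , legWeight-≤ indep z>0 j′≢i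

    indep-weight-≤-Wsum : ∃[ T ] weight g ≤ Wsum T
    indep-weight-≤-Wsum = ×.map₂ (λ {T} → subst (_≤ Wsum T) parts≡weight) parts-≤
      where
      parts≡weight : ∑ (legWeight g) + g centre ≡ weight g
      parts≡weight = trans (+-comm _ (g centre)) (sym (weight≡centre+legs g))
      parts-≤ : ∃[ T ] ∑ (legWeight g) + g centre ≤ Wsum T
      parts-≤ with least? (λ v → 0 <? g v) depth vertices
      ... | inj₁ none = fromℕ n , subst (_≤ Wsum (fromℕ n)) (sym all-silent) z≤n
        where
        all-silent : ∑ (legWeight g) + g centre ≡ 0
        all-silent = cong₂ _+_ (∑-zero λ i → silent-legs i λ p → none (∈-vertices (leg i p)))
                               (silent (none (∈-vertices centre)))
      ... | inj₂ (least centre    c>0 _)       = centre-broadcasts c>0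
      ... | inj₂ (least (leg i p) z>0 z-least) = leg-broadcasts-first i p z>0 z-least

  candidateBroadcast : Fin (suc n) → Vertex → ℕ
  candidateBroadcast T centre    = 0
  candidateBroadcast T (leg i p) = updateAt (replicate (len i) 0) (fromℕ (m i)) (const (candidate T i)) p

  candidateBroadcast-leaf : ∀ T i → candidateBroadcast T (leaf i) ≡ candidate T i
  candidateBroadcast-leaf T i = updateAt-updates (fromℕ (m i)) (replicate (len i) 0)

  candidateBroadcast-inner : ∀ T {i} p → p ≢ fromℕ (m i) → candidateBroadcast T (leg i p) ≡ 0
  candidateBroadcast-inner T {i} p p≢leaf = updateAt-minimal p (fromℕ (m i)) (replicate (len i) 0) p≢leaf

  weight-candidateBroadcast : ∀ T → weight (candidateBroadcast T) ≡ Wsum T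
  weight-candidateBroadcast T = trans (weight≡centre+legs (candidateBroadcast T)) (sum-cong-≗ on-leg)
    where
    on-leg : ∀ i → legWeight (candidateBroadcast T) i ≡ candidate T i
    on-leg i = trans (∑-concentrated (fromℕ (m i)) (candidateBroadcast-inner T)) (candidateBroadcast-leaf T i)

  candidateBroadcast-positive : ∀ T {v} → 0 < candidateBroadcast T v → ∃[ i ] inject₁ T Fin.≤ i × v ≡ leaf i
  candidateBroadcast-positive T {leg i p} pos with p Fin.≟ fromℕ (m i)
  ... | yes refl     = i , candidate-positive (subst (0 <_) (candidateBroadcast-leaf T i) pos) , refl
  ... | no  p≢leaf   = contradiction (subst (0 <_) (candidateBroadcast-inner T p p≢leaf) pos) (<-irrefl refl)

  candidateBroadcast-isBroadcast : ∀ T → IsBroadcast (candidateBroadcast T)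
  candidateBroadcast-isBroadcast T v = bounded-if-positive λ pos → bound (candidateBroadcast-positive T pos)
    where
    partner : ∀ i → ∃[ j ] inject₁ T Fin.≤ j × j ≢ i
    partner i with i Fin.≟ inject₁ T
    ... | yes refl = suc T , <⇒≤ (inject₁<suc T) , Finₚ.<⇒≢ (inject₁<suc T) ∘ sym
    ... | no  i≢T  = inject₁ T , Finₚ.≤-refl , i≢T ∘ sym
    bound : ∃[ i ] inject₁ T Fin.≤ i × v ≡ leaf i → candidateBroadcast T v ≤ ecc v
    bound (i , _ , refl) with partner i
    ... | j , T≤j , j≢i = begin
      candidateBroadcast T (leaf i) ≡⟨ candidateBroadcast-leaf T i ⟩
      candidate T i                 ≤⟨ <⇒≤ (candidate-<-len T≤j j≢i) ⟩
      len i + len j                 ≡⟨ dist-leaves (j≢i ∘ sym) ⟨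
      dist (leaf i) (leaf j)        ≤⟨ dist-≤-ecc (leaf i) (leaf j) ⟩
      ecc (leaf i)                  ∎
      where open ≤-Reasoning

  candidateBroadcast-isIndependent : ∀ T → IsIndependent (candidateBroadcast T)
  candidateBroadcast-isIndependent T v w v>0 w>0 v-hears-w
    with candidateBroadcast-positive T {v} v>0 | candidateBroadcast-positive T {w} w>0
  ... | i , T≤i , refl | j , _ , refl = separate (i Fin.≟ j)
    where
    separate : Dec (i ≡ j) → leaf i ≡ leaf j
    separate (yes i≡j) = cong leaf i≡j
    separate (no  i≢j) = contradiction v-hears-w (<⇒≱ (begin-strict
      candidateBroadcast T (leaf j) ≡⟨ candidateBroadcast-leaf T j ⟩
      candidate T j                 <⟨ candidate-<-len T≤i i≢j ⟩
      len j + len i                 ≡⟨ +-comm (len j) (len i) ⟩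
      len i + len j                 ≡⟨ dist-leaves i≢j ⟨
      dist (leaf i) (leaf j)        ∎))
      where open ≤-Reasoning

  -- If three consecutive legs T, T + 1, T + 2 have equal length, moving the threshold from T + 1 to T
  -- adds leaf T at no cost to the others.
  Wsum-step : ∀ (T : Fin n) → m (inject₁ (inject₁ T)) ≡ m (suc (suc T)) → Wsum (suc T) < Wsum (inject₁ T)
  Wsum-step T equal = subst₂ _≤_ (+-comm (Wsum (suc T)) 1) (+-identityʳ (Wsum (inject₁ T))) (∑-≤-at T₁ off at)
    where
    T₁ : Fin (suc (suc n))
    T₁ = inject₁ (inject₁ T)
    T₁<T₂ : T₁ Fin.< suc (inject₁ T)
    T₁<T₂ = inject₁<suc (inject₁ T)
    off : ∀ j → j ≢ T₁ → candidate (suc T) j ≤ candidate (inject₁ T) j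
    off j j≢T₁ with toℕ j ≤? toℕ T₁
    ... | yes j≤T₁ = subst (_≤ candidate (inject₁ T) j)
                       (sym (candidate-below (Finₚ.<-trans (Finₚ.≤∧≢⇒< j≤T₁ j≢T₁) T₁<T₂))) z≤n
    ... | no  j≰T₁ = begin
      candidate (suc T) j        ≤⟨ candidate-≤ (suc T) j ⟩
      m j + len (suc (suc T))    ≡⟨ cong (λ l → m j + suc l) equal ⟨
      m j + len T₁               ≡⟨ candidate-above (≰⇒> j≰T₁) ⟨
      candidate (inject₁ T) j    ∎
      where open ≤-Reasoning
    at : candidate (suc T) T₁ + 1 ≤ candidate (inject₁ T) T₁ + 0
    at = begin
      candidate (suc T) T₁ + 1          ≡⟨ cong (_+ 1) (candidate-below T₁<T₂) ⟩
      1                                 ≤⟨ ≤-trans (s≤s z≤n) (m≤n+m (len (suc (inject₁ T))) (m T₁)) ⟩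
      m T₁ + len (suc (inject₁ T))      ≡⟨ candidate-at (inject₁ T) ⟨
      candidate (inject₁ T) T₁          ≡⟨ +-identityʳ _ ⟨
      candidate (inject₁ T) T₁ + 0      ∎
      where open ≤-Reasoning

  maximal-threshold-separates : ∀ T → (∀ T′ → Wsum T′ ≤ Wsum T) →
                                ∀ {l r} → l Fin.< inject₁ T → inject₁ T Fin.< r → m l ≢ m r
  maximal-threshold-separates (suc T) maximal {l} {r} l<T T<r ml≡mr =
    contradiction (maximal (inject₁ T)) (<⇒≱ (Wsum-step T squeezed))
    where
    T₁ : Fin (suc (suc n))
    T₁ = inject₁ (inject₁ T)
    l≤T₁ : l Fin.≤ T₁
    l≤T₁ = subst (toℕ l ≤_) (sym (toℕ-inject₁ (inject₁ T))) (s≤s⁻¹ l<T)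
    T₁≤T₃ : T₁ Fin.≤ suc (suc T)
    T₁≤T₃ = ≤-trans (<⇒≤ (inject₁<suc (inject₁ T))) (s≤s (<⇒≤ (inject₁<suc T)))
    squeezed : m T₁ ≡ m (suc (suc T))
    squeezed = ≤-antisym (sorted T₁ (suc (suc T)) T₁≤T₃) (begin
      m (suc (suc T)) ≤⟨ sorted _ r (inject₁<⇒suc≤ T<r) ⟩
      m r             ≡⟨ ml≡mr ⟨
      m l             ≤⟨ sorted l T₁ l≤T₁ ⟩
      m T₁            ∎)
      where open ≤-Reasoning

  best : Fin (suc n)
  best = argmax Wsum zero (allFin (suc n))

  Wsum-≤-best : ∀ T → Wsum T ≤ Wsum best
  Wsum-≤-best T = All.lookup (f[xs]≤f[argmax] {f = Wsum} zero (allFin (suc n))) (∈-allFin T)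

  module Optimal (T* : Fin (suc n)) (T*-maximal : ∀ T → Wsum T ≤ Wsum T*) where

    optimal : Vertex → ℕ
    optimal = candidateBroadcast T*

    optimal-isMax : IsMaxIndepBroadcast optimal
    optimal-isMax = (candidateBroadcast-isBroadcast T* , candidateBroadcast-isIndependent T*) , dominates
      where
      dominates : ∀ g → IsIndepBroadcast g → weight g ≤ weight optimal
      dominates g (bcast , indep) with indep-weight-≤-Wsum bcast indep
      ... | T , g≤T = ≤-trans g≤T (≤-trans (T*-maximal T) (≤-reflexive (sym (weight-candidateBroadcast T*))))

    optimal-leaves : ∀ i → inject₁ T* Fin.≤ i → 0 < optimal (leaf i)
    optimal-leaves i T*≤i = subst (0 <_) (sym (candidateBroadcast-leaf T* i))
      (≤-trans (s≤s z≤n) (≤-trans (m≤n+m (len (inject₁ T*)) (m i)) (candidate-≥ T*≤i)))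

    optimal-silent : ∀ v → ¬ (∃[ i ] (inject₁ T* Fin.≤ i × v ≡ leaf i)) → optimal v ≡ 0
    optimal-silent v not-leaf = n≤0⇒n≡0 (≮⇒≥ (not-leaf ∘ candidateBroadcast-positive T*))

    optimal-equal-lengths : ∀ i j → i ≢ j → m i ≡ m j → 0 < optimal (leaf i) → 0 < optimal (leaf j) →
                            ∀ l → m l ≡ m i → 0 < optimal (leaf l)
    optimal-equal-lengths i j i≢j mi≡mj i>0 j>0 l ml≡mi with toℕ (inject₁ T*) ≤? toℕ l
    ... | yes T*≤l = optimal-leaves l T*≤l
    ... | no  T*≰l with toℕ (inject₁ T*) <? toℕ i
    ...   | yes T*<i = contradiction ml≡mi (maximal-threshold-separates T* T*-maximal (≰⇒> T*≰l) T*<i)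
    ...   | no  T*≮i = contradiction (trans ml≡mi mi≡mj)
                           (maximal-threshold-separates T* T*-maximal (≰⇒> T*≰l) T*<j)
      where
      on-leaf : ∀ {x} → 0 < optimal (leaf x) → inject₁ T* Fin.≤ x
      on-leaf x>0 = candidate-positive (subst (0 <_) (candidateBroadcast-leaf T* _) x>0)
      i≡T* : i ≡ inject₁ T*
      i≡T* = Finₚ.≤-antisym (≮⇒≥ T*≮i) (on-leaf i>0)
      T*<j : inject₁ T* Fin.< j
      T*<j = Finₚ.≤∧≢⇒< (on-leaf j>0) (λ T*≡j → i≢j (trans i≡T* T*≡j))

mainTheorem18 : (k : ℕ) → 3 ≤ k → (m : Fin k → ℕ)
  → ((i j : Fin k) → i Fin.≤ j → m i ≤ m j)
  → let open Spider k m in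
    Σ (Vertex → ℕ) λ f → Σ (Fin k) λ t →
      IsMaxIndepBroadcast f
      × ((i : Fin k) → t Fin.≤ i → 0 < f (leaf i))
      × ((v : Vertex) → ¬ (∃[ i ] (t Fin.≤ i × v ≡ leaf i)) → f v ≡ 0)
      × ((i j : Fin k) → i ≢ j → m i ≡ m j → 0 < f (leaf i) → 0 < f (leaf j)
          → (l : Fin k) → m l ≡ m i → 0 < f (leaf l))
mainTheorem18 (suc (suc (suc n))) (s≤s (s≤s (s≤s z≤n))) m sorted =
  optimal , inject₁ best , optimal-isMax , optimal-leaves , optimal-silent , optimal-equal-lengths
  where
  open SortedSpider (suc n) m sorted
  open Optimal best Wsum-≤-best
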